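{- Let $n$ and $i$ be integers with $2\le i<n$. If $n>\frac{4^i-1}{3}$, then $d_4(n,n-i)=2$.
   Context: Let $\mathbb{F}_4=\{0,1,\omega,\omega^2\}$ with $\omega^2=\omega+1$, and for $x\in\mathbb{F}_4$ let $\overline{x}=x^2$. An $[n,k]_4$ code is a $k$-dimensional subspace $C$ of $\mathbb{F}_4^n$. Its minimum weight is the smallest number of nonzero coordinates of a nonzero vector of $C$. The Hermitian dual is $C^{\perp_H}=\{x\in\mathbb{F}_4^n:\sum_i x_i\overline{y_i}=0\ \forall y\in C\}$, and $C$ is Hermitian LCD if $C\cap C^{\perp_H}=\{\mathbf{0}_n\}$. $d_4(n,k)$ denotes the largest minimum weight among all Hermitian LCD $[n,k]_4$ codes. -}

module Defs where

open import Data.Nat using (ℕ; zero; suc; _+_; _≤_)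
open import Data.Fin using (Fin) renaming (zero to fz; suc to fs)
open import Data.Product using (Σ; ∃; _×_; _,_)
open import Relation.Nullary using (¬_)
open import Relation.Binary.PropositionalEquality using (_≡_)

-- The field F4 = {0, 1, ω, ω²} with ω² = ω + 1
data F4 : Set where
  𝟎 𝟏 ω ω² : F4

infixl 6 _⊕_
infixl 7 _⊗_

_⊕_ : F4 → F4 → F4
𝟎 ⊕ y = y
x ⊕ 𝟎 = x
𝟏 ⊕ 𝟏 = 𝟎
𝟏 ⊕ ω = ω²
𝟏 ⊕ ω² = ω
ω ⊕ 𝟏 = ω²
ω ⊕ ω = 𝟎
ω ⊕ ω² = 𝟏
ω² ⊕ 𝟏 = ω
ω² ⊕ ω = 𝟏
ω² ⊕ ω² = 𝟎

_⊗_ : F4 → F4 → F4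
𝟎 ⊗ y = 𝟎
x ⊗ 𝟎 = 𝟎
𝟏 ⊗ y = y
x ⊗ 𝟏 = x
ω ⊗ ω = ω²
ω ⊗ ω² = 𝟏
ω² ⊗ ω = 𝟏
ω² ⊗ ω² = ω

conj : F4 → F4
conj x = x ⊗ x

Vec4 : ℕ → Set
Vec4 n = Fin n → F4

tail4 : ∀ {n} → Vec4 (suc n) → Vec4 n
tail4 x j = x (fs j)

nz : F4 → ℕ
nz 𝟎 = 0
nz _ = 1

weight : ∀ {n} → Vec4 n → ℕ
weight {zero} x = 0
weight {suc n} x = nz (x fz) + weight (tail4 x)

herm : ∀ {n} → Vec4 n → Vec4 n → F4
herm {zero} x y = 𝟎
herm {suc n} x y = (x fz ⊗ conj (y fz)) ⊕ herm (tail4 x) (tail4 y)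

IsZero : ∀ {n} → Vec4 n → Set
IsZero x = ∀ j → x j ≡ 𝟎

lincomb : ∀ {n k} → (Fin k → F4) → (Fin k → Vec4 n) → Vec4 n
lincomb {n} {zero} c b i = 𝟎
lincomb {n} {suc k} c b i = (c fz ⊗ b fz i) ⊕ lincomb (λ j → c (fs j)) (λ j → b (fs j)) i

record Code (n k : ℕ) : Set where
  field
    basis : Fin k → Vec4 n
    indep : ∀ (c : Fin k → F4) → IsZero (lincomb c basis) → ∀ j → c j ≡ 𝟎

open Code public

_∈C_ : ∀ {n k} → Vec4 n → Code n k → Set
x ∈C C = ∃ λ c → ∀ i → x i ≡ lincomb c (basis C) i

HermLCD : ∀ {n k} → Code n k → Set
HermLCD C = ∀ x → x ∈C C → (∀ y → y ∈C C → herm x y ≡ 𝟎) → IsZero x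

MinWeight : ∀ {n k} → Code n k → ℕ → Set
MinWeight C d =
  (∃ λ x → x ∈C C × ¬ IsZero x × weight x ≡ d) ×
  (∀ x → x ∈C C → ¬ IsZero x → d ≤ weight x)

IsD4 : ℕ → ℕ → ℕ → Set
IsD4 n k d =
  (Σ (Code n k) λ C → HermLCD C × MinWeight C d) ×
  (∀ (C : Code n k) → HermLCD C → ∀ d' → MinWeight C d' → d' ≤ d)

-- Upper bound (sphere packing): the translates of an [n, k]_4 code C by the 1 + 3n vectors of
-- weight at most 1 are (1 + 3n)·4^k vectors of F4^n; when this exceeds 4^n two of them
-- coincide, and the difference of the two shifts is a nonzero codeword of weight at most 2.
-- With k = n - i this happens as soon as 4^i ≤ 3n.
-- Lower bound: for 2 ≤ k ≤ n - 2 the code with generator matrix [1 1 | I_k | 0] has minimum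
-- weight 2 and is Hermitian LCD, since the Hermitian product of a codeword with the l-th
-- generator is its l-th message symbol. The hypothesis 4^i ≤ 3n forces n ≥ i + 2.
module Submission where

open import Defs
open import Data.Nat using (ℕ; zero; suc; _+_; _*_; _^_; _∸_; _≤_; _<_; z≤n; s≤s; s≤s⁻¹)
open import Data.Nat.Properties
  using (≤-refl; ≤-trans; ≤-reflexive; <⇒≤; <-irrefl; ≮⇒≥; m≤m+n; m≤n+m; +-comm; +-identityʳ;
         +-mono-≤; +-monoˡ-≤; +-monoʳ-<; *-monoʳ-≤; *-monoˡ-<; *-suc; suc-injective; suc-pred;
         m^n≢0; m^n>0; ^-distribˡ-+-*; m+[n∸m]≡n; m+n∸n≡m; ∸-monoˡ-≤; m≤n⇒∃[o]m+o≡n;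
         m+n≡0⇒m≡0; m+n≡0⇒n≡0; +-commutativeSemigroup; module ≤-Reasoning)
open import Data.Fin using (Fin; _↑ˡ_; remQuot; combine; funToFin; finToFun)
  renaming (zero to fz; suc to fs)
open import Data.Fin.Properties
  using (combine-remQuot; finToFun-funToFin; funToFin-finToFin; pigeonhole)
  renaming (_≟_ to _≟ᶠ_; <⇒≢ to <⇒≢ᶠ; suc-injective to fs-injective)
open import Data.Product using (Σ; ∃; ∃₂; _×_; _,_; proj₂; uncurry)
open import Function using (_∘_)
open import Relation.Nullary using (¬_; yes; no)
open import Relation.Binary.PropositionalEquality
open import Relation.Binary.PropositionalEquality.Algebra using (isMagma)
open import Data.Empty using (⊥-elim)
open import Algebra.Bundles using (CommutativeSemigroup)
import Algebra.Properties.CommutativeSemigroup as CommutativeSemigroupProperties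

⊕-identityʳ : ∀ a → a ⊕ 𝟎 ≡ a
⊕-identityʳ 𝟎 = refl
⊕-identityʳ 𝟏 = refl
⊕-identityʳ ω = refl
⊕-identityʳ ω² = refl

⊕-self : ∀ a → a ⊕ a ≡ 𝟎
⊕-self 𝟎 = refl
⊕-self 𝟏 = refl
⊕-self ω = refl
⊕-self ω² = refl

⊕≡𝟎⇒≡ : ∀ a b → a ⊕ b ≡ 𝟎 → a ≡ b
⊕≡𝟎⇒≡ 𝟎 𝟎 _ = refl
⊕≡𝟎⇒≡ 𝟏 𝟏 _ = refl
⊕≡𝟎⇒≡ ω ω _ = refl
⊕≡𝟎⇒≡ ω² ω² _ = refl
⊕≡𝟎⇒≡ 𝟎 𝟏 ()
⊕≡𝟎⇒≡ 𝟎 ω ()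
⊕≡𝟎⇒≡ 𝟎 ω² ()
⊕≡𝟎⇒≡ 𝟏 𝟎 ()
⊕≡𝟎⇒≡ 𝟏 ω ()
⊕≡𝟎⇒≡ 𝟏 ω² ()
⊕≡𝟎⇒≡ ω 𝟎 ()
⊕≡𝟎⇒≡ ω 𝟏 ()
⊕≡𝟎⇒≡ ω ω² ()
⊕≡𝟎⇒≡ ω² 𝟎 ()
⊕≡𝟎⇒≡ ω² 𝟏 ()
⊕≡𝟎⇒≡ ω² ω ()

⊗-zeroʳ : ∀ a → a ⊗ 𝟎 ≡ 𝟎
⊗-zeroʳ 𝟎 = refl
⊗-zeroʳ 𝟏 = refl
⊗-zeroʳ ω = refl
⊗-zeroʳ ω² = refl

⊗-identityˡ : ∀ a → 𝟏 ⊗ a ≡ a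
⊗-identityˡ 𝟎 = refl
⊗-identityˡ 𝟏 = refl
⊗-identityˡ ω = refl
⊗-identityˡ ω² = refl

⊗-identityʳ : ∀ a → a ⊗ 𝟏 ≡ a
⊗-identityʳ 𝟎 = refl
⊗-identityʳ 𝟏 = refl
⊗-identityʳ ω = refl
⊗-identityʳ ω² = refl

⊕-comm : ∀ a b → a ⊕ b ≡ b ⊕ a
⊕-comm 𝟎 b = sym (⊕-identityʳ b)
⊕-comm 𝟏 𝟎 = refl
⊕-comm 𝟏 𝟏 = refl
⊕-comm 𝟏 ω = refl
⊕-comm 𝟏 ω² = refl
⊕-comm ω 𝟎 = refl
⊕-comm ω 𝟏 = refl
⊕-comm ω ω = refl
⊕-comm ω ω² = refl
⊕-comm ω² 𝟎 = refl
⊕-comm ω² 𝟏 = refl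
⊕-comm ω² ω = refl
⊕-comm ω² ω² = refl

⊕-assoc : ∀ a b c → (a ⊕ b) ⊕ c ≡ a ⊕ (b ⊕ c)
⊕-assoc 𝟎 b c = refl
⊕-assoc 𝟏 𝟎 c = refl
⊕-assoc 𝟏 𝟏 𝟎 = refl
⊕-assoc 𝟏 𝟏 𝟏 = refl
⊕-assoc 𝟏 𝟏 ω = refl
⊕-assoc 𝟏 𝟏 ω² = refl
⊕-assoc 𝟏 ω 𝟎 = refl
⊕-assoc 𝟏 ω 𝟏 = refl
⊕-assoc 𝟏 ω ω = refl
⊕-assoc 𝟏 ω ω² = refl
⊕-assoc 𝟏 ω² 𝟎 = refl
⊕-assoc 𝟏 ω² 𝟏 = refl
⊕-assoc 𝟏 ω² ω = refl
⊕-assoc 𝟏 ω² ω² = refl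
⊕-assoc ω 𝟎 c = refl
⊕-assoc ω 𝟏 𝟎 = refl
⊕-assoc ω 𝟏 𝟏 = refl
⊕-assoc ω 𝟏 ω = refl
⊕-assoc ω 𝟏 ω² = refl
⊕-assoc ω ω 𝟎 = refl
⊕-assoc ω ω 𝟏 = refl
⊕-assoc ω ω ω = refl
⊕-assoc ω ω ω² = refl
⊕-assoc ω ω² 𝟎 = refl
⊕-assoc ω ω² 𝟏 = refl
⊕-assoc ω ω² ω = refl
⊕-assoc ω ω² ω² = refl
⊕-assoc ω² 𝟎 c = refl
⊕-assoc ω² 𝟏 𝟎 = refl
⊕-assoc ω² 𝟏 𝟏 = refl
⊕-assoc ω² 𝟏 ω = refl
⊕-assoc ω² 𝟏 ω² = refl
⊕-assoc ω² ω 𝟎 = refl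
⊕-assoc ω² ω 𝟏 = refl
⊕-assoc ω² ω ω = refl
⊕-assoc ω² ω ω² = refl
⊕-assoc ω² ω² 𝟎 = refl
⊕-assoc ω² ω² 𝟏 = refl
⊕-assoc ω² ω² ω = refl
⊕-assoc ω² ω² ω² = refl

⊗-distribʳ-⊕ : ∀ a b z → (a ⊕ b) ⊗ z ≡ a ⊗ z ⊕ b ⊗ z
⊗-distribʳ-⊕ 𝟎 b z = refl
⊗-distribʳ-⊕ 𝟏 𝟎 z = sym (⊕-identityʳ (𝟏 ⊗ z))
⊗-distribʳ-⊕ 𝟏 𝟏 𝟎 = refl
⊗-distribʳ-⊕ 𝟏 𝟏 𝟏 = refl
⊗-distribʳ-⊕ 𝟏 𝟏 ω = refl
⊗-distribʳ-⊕ 𝟏 𝟏 ω² = refl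
⊗-distribʳ-⊕ 𝟏 ω 𝟎 = refl
⊗-distribʳ-⊕ 𝟏 ω 𝟏 = refl
⊗-distribʳ-⊕ 𝟏 ω ω = refl
⊗-distribʳ-⊕ 𝟏 ω ω² = refl
⊗-distribʳ-⊕ 𝟏 ω² 𝟎 = refl
⊗-distribʳ-⊕ 𝟏 ω² 𝟏 = refl
⊗-distribʳ-⊕ 𝟏 ω² ω = refl
⊗-distribʳ-⊕ 𝟏 ω² ω² = refl
⊗-distribʳ-⊕ ω 𝟎 z = sym (⊕-identityʳ (ω ⊗ z))
⊗-distribʳ-⊕ ω 𝟏 𝟎 = refl
⊗-distribʳ-⊕ ω 𝟏 𝟏 = refl
⊗-distribʳ-⊕ ω 𝟏 ω = refl
⊗-distribʳ-⊕ ω 𝟏 ω² = refl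
⊗-distribʳ-⊕ ω ω 𝟎 = refl
⊗-distribʳ-⊕ ω ω 𝟏 = refl
⊗-distribʳ-⊕ ω ω ω = refl
⊗-distribʳ-⊕ ω ω ω² = refl
⊗-distribʳ-⊕ ω ω² 𝟎 = refl
⊗-distribʳ-⊕ ω ω² 𝟏 = refl
⊗-distribʳ-⊕ ω ω² ω = refl
⊗-distribʳ-⊕ ω ω² ω² = refl
⊗-distribʳ-⊕ ω² 𝟎 z = sym (⊕-identityʳ (ω² ⊗ z))
⊗-distribʳ-⊕ ω² 𝟏 𝟎 = refl
⊗-distribʳ-⊕ ω² 𝟏 𝟏 = refl
⊗-distribʳ-⊕ ω² 𝟏 ω = refl
⊗-distribʳ-⊕ ω² 𝟏 ω² = refl
⊗-distribʳ-⊕ ω² ω 𝟎 = refl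
⊗-distribʳ-⊕ ω² ω 𝟏 = refl
⊗-distribʳ-⊕ ω² ω ω = refl
⊗-distribʳ-⊕ ω² ω ω² = refl
⊗-distribʳ-⊕ ω² ω² 𝟎 = refl
⊗-distribʳ-⊕ ω² ω² 𝟏 = refl
⊗-distribʳ-⊕ ω² ω² ω = refl
⊗-distribʳ-⊕ ω² ω² ω² = refl

⊕-commutativeSemigroup : CommutativeSemigroup _ _
⊕-commutativeSemigroup = record
  { _≈_ = _≡_
  ; _∙_ = _⊕_
  ; isCommutativeSemigroup = record
      { isSemigroup = record { isMagma = isMagma _⊕_ ; assoc = ⊕-assoc }
      ; comm = ⊕-comm
      }
  }

open CommutativeSemigroupProperties ⊕-commutativeSemigroup using ()
  renaming (interchange to ⊕-interchange)
open CommutativeSemigroupProperties +-commutativeSemigroup using ()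
  renaming (interchange to +-interchange)

⊕-cancelˡ : ∀ a b → a ⊕ (a ⊕ b) ≡ b
⊕-cancelˡ a b = begin
  a ⊕ (a ⊕ b) ≡⟨ ⊕-assoc a a b ⟨
  (a ⊕ a) ⊕ b ≡⟨ cong (_⊕ b) (⊕-self a) ⟩
  b           ∎
  where open ≡-Reasoning

-- In characteristic 2 a summand changes sides without changing sign.
⊕-exchange : ∀ a b a′ b′ → a ⊕ b ≡ a′ ⊕ b′ → a ⊕ a′ ≡ b ⊕ b′
⊕-exchange a b a′ b′ eq = ⊕≡𝟎⇒≡ (a ⊕ a′) (b ⊕ b′) (begin
  (a ⊕ a′) ⊕ (b ⊕ b′)   ≡⟨ ⊕-interchange a a′ b b′ ⟩
  (a ⊕ b) ⊕ (a′ ⊕ b′)   ≡⟨ cong (_⊕ (a′ ⊕ b′)) eq ⟩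
  (a′ ⊕ b′) ⊕ (a′ ⊕ b′) ≡⟨ ⊕-self (a′ ⊕ b′) ⟩
  𝟎                     ∎)
  where open ≡-Reasoning

≢𝟎⊕≡𝟎 : ∀ {a b} → a ≢ 𝟎 → b ≡ 𝟎 → a ⊕ b ≢ 𝟎
≢𝟎⊕≡𝟎 {a} a≢𝟎 refl = a≢𝟎 ∘ trans (sym (⊕-identityʳ a))

nz≤1 : ∀ a → nz a ≤ 1
nz≤1 𝟎 = z≤n
nz≤1 𝟏 = ≤-refl
nz≤1 ω = ≤-refl
nz≤1 ω² = ≤-refl

nz-⊕ : ∀ a b → nz (a ⊕ b) ≤ nz a + nz b
nz-⊕ 𝟎 b = ≤-refl
nz-⊕ 𝟏 b = ≤-trans (nz≤1 (𝟏 ⊕ b)) (m≤m+n 1 (nz b))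
nz-⊕ ω b = ≤-trans (nz≤1 (ω ⊕ b)) (m≤m+n 1 (nz b))
nz-⊕ ω² b = ≤-trans (nz≤1 (ω² ⊕ b)) (m≤m+n 1 (nz b))

nz≡0⇒≡𝟎 : ∀ {a} → nz a ≡ 0 → a ≡ 𝟎
nz≡0⇒≡𝟎 {𝟎} _ = refl

≢𝟎⇒nz≡1 : ∀ {a} → a ≢ 𝟎 → nz a ≡ 1
≢𝟎⇒nz≡1 {𝟎} a≢𝟎 = ⊥-elim (a≢𝟎 refl)
≢𝟎⇒nz≡1 {𝟏} _ = refl
≢𝟎⇒nz≡1 {ω} _ = refl
≢𝟎⇒nz≡1 {ω²} _ = refl

infixl 6 _⊕ᵥ_

_⊕ᵥ_ : ∀ {n} → Vec4 n → Vec4 n → Vec4 n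
(x ⊕ᵥ y) p = x p ⊕ y p

𝟎ᵥ : ∀ {n} → Vec4 n
𝟎ᵥ _ = 𝟎

unitv : ∀ {n} → Fin n → F4 → Vec4 n
unitv fz a fz = a
unitv fz a (fs _) = 𝟎
unitv (fs j) a fz = 𝟎
unitv (fs j) a (fs p) = unitv j a p

unitv-diag : ∀ {n} (j : Fin n) a → unitv j a j ≡ a
unitv-diag fz a = refl
unitv-diag (fs j) a = unitv-diag j a

unitv-offDiag : ∀ {n} {j p : Fin n} a → j ≢ p → unitv j a p ≡ 𝟎
unitv-offDiag {j = fz} {fz} a j≢p = ⊥-elim (j≢p refl)
unitv-offDiag {j = fz} {fs p} a j≢p = refl
unitv-offDiag {j = fs j} {fz} a j≢p = refl
unitv-offDiag {j = fs j} {fs p} a j≢p = unitv-offDiag a (j≢p ∘ cong fs)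

unitv-injective : ∀ {n} {j j′ : Fin n} {a a′} → a ≢ 𝟎 →
                  unitv j a ≗ unitv j′ a′ → j ≡ j′ × a ≡ a′
unitv-injective {j = j} {j′} {a} {a′} a≢𝟎 eq with j ≟ᶠ j′
... | yes refl = refl , trans (sym (unitv-diag j a)) (trans (eq j) (unitv-diag j a′))
... | no j≢j′ = ⊥-elim (a≢𝟎 (trans (sym (unitv-diag j a)) (trans (eq j) (unitv-offDiag a′ (j≢j′ ∘ sym)))))

sum : ∀ {k} → Vec4 k → F4
sum {zero} c = 𝟎
sum {suc k} c = c fz ⊕ sum (tail4 c)

sum-cong : ∀ {k} {c c′ : Vec4 k} → c ≗ c′ → sum c ≡ sum c′
sum-cong {zero} eq = refl
sum-cong {suc k} eq = cong₂ _⊕_ (eq fz) (sum-cong (eq ∘ fs))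

sum-𝟎ᵥ : ∀ k → sum (𝟎ᵥ {k}) ≡ 𝟎
sum-𝟎ᵥ zero = refl
sum-𝟎ᵥ (suc k) = sum-𝟎ᵥ k

sum-zero : ∀ {k} {c : Vec4 k} → IsZero c → sum c ≡ 𝟎
sum-zero {k} c≡𝟎 = trans (sum-cong c≡𝟎) (sum-𝟎ᵥ k)

lincomb-sum : ∀ {n k} (c : Vec4 k) (b : Fin k → Vec4 n) p →
              lincomb c b p ≡ sum (λ j → c j ⊗ b j p)
lincomb-sum {k = zero} c b p = refl
lincomb-sum {k = suc k} c b p = cong (c fz ⊗ b fz p ⊕_) (lincomb-sum (tail4 c) (b ∘ fs) p)

lincomb-zeroˡ : ∀ {n k} {c : Vec4 k} (b : Fin k → Vec4 n) → IsZero c → IsZero (lincomb c b)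
lincomb-zeroˡ {c = c} b c≡𝟎 p = begin
  lincomb c b p              ≡⟨ lincomb-sum c b p ⟩
  sum (λ j → c j ⊗ b j p)   ≡⟨ sum-zero (λ j → cong (_⊗ b j p) (c≡𝟎 j)) ⟩
  𝟎                          ∎
  where open ≡-Reasoning

lincomb-⊕ : ∀ {n k} (c c′ : Vec4 k) (b : Fin k → Vec4 n) p →
            lincomb (c ⊕ᵥ c′) b p ≡ lincomb c b p ⊕ lincomb c′ b p
lincomb-⊕ {k = zero} c c′ b p = refl
lincomb-⊕ {k = suc k} c c′ b p = begin
  (c fz ⊕ c′ fz) ⊗ b fz p ⊕ lincomb (tail4 c ⊕ᵥ tail4 c′) (b ∘ fs) p
    ≡⟨ cong₂ _⊕_ (⊗-distribʳ-⊕ (c fz) (c′ fz) (b fz p)) (lincomb-⊕ (tail4 c) (tail4 c′) (b ∘ fs) p) ⟩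
  (c fz ⊗ b fz p ⊕ c′ fz ⊗ b fz p) ⊕ (lincomb (tail4 c) (b ∘ fs) p ⊕ lincomb (tail4 c′) (b ∘ fs) p)
    ≡⟨ ⊕-interchange (c fz ⊗ b fz p) (c′ fz ⊗ b fz p) _ _ ⟩
  lincomb c b p ⊕ lincomb c′ b p
    ∎
  where open ≡-Reasoning

lincomb-unitvˡ : ∀ {n k} (l : Fin k) (b : Fin k → Vec4 n) p → lincomb (unitv l 𝟏) b p ≡ b l p
lincomb-unitvˡ fz b p = begin
  𝟏 ⊗ b fz p ⊕ lincomb 𝟎ᵥ (b ∘ fs) p ≡⟨ cong₂ _⊕_ (⊗-identityˡ (b fz p)) (lincomb-zeroˡ (b ∘ fs) (λ _ → refl) p) ⟩
  b fz p ⊕ 𝟎                          ≡⟨ ⊕-identityʳ (b fz p) ⟩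
  b fz p                              ∎
  where open ≡-Reasoning
lincomb-unitvˡ (fs l) b p = lincomb-unitvˡ l (b ∘ fs) p

basis-∈C : ∀ {n k} (C : Code n k) l → basis C l ∈C C
basis-∈C C l = unitv l 𝟏 , λ p → sym (lincomb-unitvˡ l (basis C) p)

weight-cong : ∀ {n} {x y : Vec4 n} → x ≗ y → weight x ≡ weight y
weight-cong {zero} eq = refl
weight-cong {suc n} eq = cong₂ _+_ (cong nz (eq fz)) (weight-cong (eq ∘ fs))

weight-𝟎ᵥ : ∀ n → weight (𝟎ᵥ {n}) ≡ 0
weight-𝟎ᵥ zero = refl
weight-𝟎ᵥ (suc n) = weight-𝟎ᵥ n

weight≡0⇒IsZero : ∀ {n} (x : Vec4 n) → weight x ≡ 0 → IsZero x
weight≡0⇒IsZero {suc n} x w≡0 fz = nz≡0⇒≡𝟎 (m+n≡0⇒m≡0 (nz (x fz)) w≡0)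
weight≡0⇒IsZero {suc n} x w≡0 (fs p) = weight≡0⇒IsZero (tail4 x) (m+n≡0⇒n≡0 (nz (x fz)) w≡0) p

weight-⊕ᵥ : ∀ {n} (x y : Vec4 n) → weight (x ⊕ᵥ y) ≤ weight x + weight y
weight-⊕ᵥ {zero} x y = z≤n
weight-⊕ᵥ {suc n} x y = begin
  nz (x fz ⊕ y fz) + weight (tail4 x ⊕ᵥ tail4 y)
    ≤⟨ +-mono-≤ (nz-⊕ (x fz) (y fz)) (weight-⊕ᵥ (tail4 x) (tail4 y)) ⟩
  (nz (x fz) + nz (y fz)) + (weight (tail4 x) + weight (tail4 y))
    ≡⟨ +-interchange (nz (x fz)) _ _ _ ⟩
  weight x + weight y
    ∎
  where open ≤-Reasoning

weight-unitv : ∀ {n} (j : Fin n) a → weight (unitv j a) ≤ 1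
weight-unitv {suc n} fz a rewrite weight-𝟎ᵥ n | +-identityʳ (nz a) = nz≤1 a
weight-unitv (fs j) a = weight-unitv j a

weight≡1⇒sum≢𝟎 : ∀ {k} (c : Vec4 k) → weight c ≡ 1 → sum c ≢ 𝟎
weight≡1⇒sum≢𝟎 {suc k} c w≡1 with c fz | w≡1
... | 𝟎 | w′≡1 = weight≡1⇒sum≢𝟎 (tail4 c) w′≡1
... | 𝟏 | 1+w≡1 = ≢𝟎⊕≡𝟎 {𝟏} (λ ()) (sum-zero (weight≡0⇒IsZero (tail4 c) (suc-injective 1+w≡1)))
... | ω | 1+w≡1 = ≢𝟎⊕≡𝟎 {ω} (λ ()) (sum-zero (weight≡0⇒IsZero (tail4 c) (suc-injective 1+w≡1)))
... | ω² | 1+w≡1 = ≢𝟎⊕≡𝟎 {ω²} (λ ()) (sum-zero (weight≡0⇒IsZero (tail4 c) (suc-injective 1+w≡1)))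

herm-zeroʳ : ∀ {n} (x : Vec4 n) → herm x 𝟎ᵥ ≡ 𝟎
herm-zeroʳ {zero} x = refl
herm-zeroʳ {suc n} x rewrite ⊗-zeroʳ (x fz) = herm-zeroʳ (tail4 x)

herm-unitvʳ : ∀ {n} (x : Vec4 n) j → herm x (unitv j 𝟏) ≡ x j
herm-unitvʳ x fz = trans (cong₂ _⊕_ (⊗-identityʳ (x fz)) (herm-zeroʳ (tail4 x))) (⊕-identityʳ (x fz))
herm-unitvʳ x (fs j) = trans (cong (_⊕ herm (tail4 x) (unitv j 𝟏)) (⊗-zeroʳ (x fz))) (herm-unitvʳ (tail4 x) j)

-- The sphere-packing bound

toFin4 : F4 → Fin 4
toFin4 𝟎 = fz
toFin4 𝟏 = fs fz
toFin4 ω = fs (fs fz)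
toFin4 ω² = fs (fs (fs fz))

fromFin4 : Fin 4 → F4
fromFin4 fz = 𝟎
fromFin4 (fs fz) = 𝟏
fromFin4 (fs (fs fz)) = ω
fromFin4 (fs (fs (fs fz))) = ω²

fromFin4-toFin4 : ∀ a → fromFin4 (toFin4 a) ≡ a
fromFin4-toFin4 𝟎 = refl
fromFin4-toFin4 𝟏 = refl
fromFin4-toFin4 ω = refl
fromFin4-toFin4 ω² = refl

toFin4-fromFin4 : ∀ t → toFin4 (fromFin4 t) ≡ t
toFin4-fromFin4 fz = refl
toFin4-fromFin4 (fs fz) = refl
toFin4-fromFin4 (fs (fs fz)) = refl
toFin4-fromFin4 (fs (fs (fs fz))) = refl

fromFin4-suc≢𝟎 : ∀ a → fromFin4 (fs a) ≢ 𝟎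
fromFin4-suc≢𝟎 fz ()
fromFin4-suc≢𝟎 (fs fz) ()
fromFin4-suc≢𝟎 (fs (fs fz)) ()

encode : ∀ {n} → Vec4 n → Fin (4 ^ n)
encode x = funToFin (toFin4 ∘ x)

decode : ∀ {n} → Fin (4 ^ n) → Vec4 n
decode t = fromFin4 ∘ finToFun t

decode-encode : ∀ {n} (x : Vec4 n) → decode (encode x) ≗ x
decode-encode x p = trans (cong fromFin4 (finToFun-funToFin (toFin4 ∘ x) p)) (fromFin4-toFin4 (x p))

encode-injective : ∀ {n} {x y : Vec4 n} → encode x ≡ encode y → x ≗ y
encode-injective {x = x} {y} eq p = begin
  x p                 ≡⟨ decode-encode x p ⟨
  decode (encode x) p ≡⟨ cong (λ t → decode t p) eq ⟩
  decode (encode y) p ≡⟨ decode-encode y p ⟩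
  y p                 ∎
  where open ≡-Reasoning

funToFin-cong : ∀ {m n} {f g : Fin m → Fin n} → f ≗ g → funToFin f ≡ funToFin g
funToFin-cong {zero} eq = refl
funToFin-cong {suc m} eq = cong₂ combine (eq fz) (funToFin-cong (eq ∘ fs))

decode-injective : ∀ {n} {t t′ : Fin (4 ^ n)} → decode {n} t ≗ decode t′ → t ≡ t′
decode-injective {n} {t} {t′} eq = begin
  t                              ≡⟨ funToFin-finToFin {n} {4} t ⟨
  funToFin (finToFun {4} {n} t)  ≡⟨ funToFin-cong finToFun-≗ ⟩
  funToFin (finToFun {4} {n} t′) ≡⟨ funToFin-finToFin {n} {4} t′ ⟩
  t′                             ∎
  where
  open ≡-Reasoning
  finToFun-≗ : finToFun {4} {n} t ≗ finToFun t′
  finToFun-≗ p = trans (sym (toFin4-fromFin4 _)) (trans (cong toFin4 (eq p)) (toFin4-fromFin4 _))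

Vec4-pigeonhole : ∀ {m n} → 4 ^ n < m → (f : Fin m → Vec4 n) → ∃₂ λ i j → i ≢ j × f i ≗ f j
Vec4-pigeonhole lt f with i , j , i<j , fi≡fj ← pigeonhole lt (encode ∘ f) =
  i , j , <⇒≢ᶠ i<j , encode-injective fi≡fj

remQuot-injective : ∀ {m} k {t t′ : Fin (m * k)} → remQuot {m} k t ≡ remQuot k t′ → t ≡ t′
remQuot-injective {m} k {t} {t′} eq =
  trans (sym (combine-remQuot {m} k t)) (trans (cong (uncurry combine) eq) (combine-remQuot {m} k t′))

scaledUnit : ∀ {n} → Fin 3 × Fin n → Vec4 n
scaledUnit (a , j) = unitv j (fromFin4 (fs a))

scaledUnit≢𝟎ᵥ : ∀ {n} (i : Fin 3 × Fin n) → ¬ scaledUnit i ≗ 𝟎ᵥ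
scaledUnit≢𝟎ᵥ (a , j) eq = fromFin4-suc≢𝟎 a (trans (sym (unitv-diag j _)) (eq j))

scaledUnit-injective : ∀ {n} {i i′ : Fin 3 × Fin n} → scaledUnit i ≗ scaledUnit i′ → i ≡ i′
scaledUnit-injective {i = a , j} {a′ , j′} eq with unitv-injective {j = j} {j′} (fromFin4-suc≢𝟎 a) eq
... | refl , fa≡fa′ =
  cong (_, j) (fs-injective (trans (sym (toFin4-fromFin4 _)) (trans (cong toFin4 fa≡fa′) (toFin4-fromFin4 _))))

-- Index 0 is the zero vector, index 1 + (a, j) the unit vector e_j scaled by the (a+1)-th nonzero scalar.
lightVec : ∀ {n} → Fin (suc (3 * n)) → Vec4 n
lightVec fz = 𝟎ᵥ
lightVec {n} (fs u) = scaledUnit (remQuot n u)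

weight-lightVec : ∀ {n} (s : Fin (suc (3 * n))) → weight (lightVec {n} s) ≤ 1
weight-lightVec {n} fz = ≤-trans (≤-reflexive (weight-𝟎ᵥ n)) z≤n
weight-lightVec {n} (fs u) = weight-unitv (proj₂ (remQuot {3} n u)) _

lightVec-injective : ∀ {n} {s s′ : Fin (suc (3 * n))} → lightVec {n} s ≗ lightVec s′ → s ≡ s′
lightVec-injective {s = fz} {fz} eq = refl
lightVec-injective {n} {fz} {fs u′} eq = ⊥-elim (scaledUnit≢𝟎ᵥ (remQuot n u′) (sym ∘ eq))
lightVec-injective {n} {fs u} {fz} eq = ⊥-elim (scaledUnit≢𝟎ᵥ (remQuot n u) eq)
lightVec-injective {n} {fs u} {fs u′} eq = cong fs (remQuot-injective n (scaledUnit-injective eq))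

module _ {n k} (C : Code n k) where

  shifted : Fin (suc (3 * n)) × Fin (4 ^ k) → Vec4 n
  shifted (s , u) = lightVec {n} s ⊕ᵥ lincomb (decode u) (basis C)

  shifted-collision : ∀ {i i′} → i ≢ i′ → shifted i ≗ shifted i′ →
                      ∃ λ x → x ∈C C × ¬ IsZero x × weight x ≤ 2
  shifted-collision {s , u} {s′ , u′} i≢i′ same = x , (c , x≗) , x≢𝟎 , weight-x
    where
    x = lightVec {n} s ⊕ᵥ lightVec {n} s′
    c = decode u ⊕ᵥ decode u′
    x≗ : x ≗ lincomb c (basis C)
    x≗ p = trans (⊕-exchange (lightVec {n} s p) _ (lightVec {n} s′ p) _ (same p))
                 (sym (lincomb-⊕ (decode u) (decode u′) (basis C) p))
    x≢𝟎 : ¬ IsZero x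
    x≢𝟎 x≡𝟎 = i≢i′ (cong₂ _,_ (lightVec-injective {n} (λ p → ⊕≡𝟎⇒≡ _ _ (x≡𝟎 p)))
                               (decode-injective (λ j → ⊕≡𝟎⇒≡ _ _ (c≡𝟎 j))))
      where c≡𝟎 = indep C c (λ p → trans (sym (x≗ p)) (x≡𝟎 p))
    weight-x : weight x ≤ 2
    weight-x = ≤-trans (weight-⊕ᵥ (lightVec {n} s) (lightVec {n} s′))
                       (+-mono-≤ (weight-lightVec {n} s) (weight-lightVec {n} s′))

  short-codeword : 4 ^ n < suc (3 * n) * 4 ^ k → ∃ λ x → x ∈C C × ¬ IsZero x × weight x ≤ 2
  short-codeword lt with t , t′ , t≢t′ , same ← Vec4-pigeonhole lt (shifted ∘ remQuot (4 ^ k)) =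
    shifted-collision (t≢t′ ∘ remQuot-injective (4 ^ k)) same

  minWeight≤2 : ∀ {d} → 4 ^ n < suc (3 * n) * 4 ^ k → MinWeight C d → d ≤ 2
  minWeight≤2 lt (_ , minimal) with x , x∈C , x≢𝟎 , weight-x ← short-codeword lt =
    ≤-trans (minimal x x∈C x≢𝟎) weight-x

-- The parity code

pad : ∀ {k} r → Vec4 k → Vec4 (k + r)
pad {zero} r c q = 𝟎
pad {suc k} r c fz = c fz
pad {suc k} r c (fs q) = pad r (tail4 c) q

pad-↑ˡ : ∀ {k} r (c : Vec4 k) j → pad r c (j ↑ˡ r) ≡ c j
pad-↑ˡ r c fz = refl
pad-↑ˡ r c (fs j) = pad-↑ˡ r (tail4 c) j

weight-pad : ∀ {k} r (c : Vec4 k) → weight (pad r c) ≡ weight c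
weight-pad {zero} r c = weight-𝟎ᵥ r
weight-pad {suc k} r c = cong (nz (c fz) +_) (weight-pad r (tail4 c))

sum-unitv↑ˡ : ∀ {k} r (c : Vec4 k) q → sum (λ j → c j ⊗ unitv (j ↑ˡ r) 𝟏 q) ≡ pad r c q
sum-unitv↑ˡ {zero} r c q = refl
sum-unitv↑ˡ {suc k} r c fz = begin
  c fz ⊗ 𝟏 ⊕ sum (λ j → c (fs j) ⊗ 𝟎) ≡⟨ cong₂ _⊕_ (⊗-identityʳ (c fz)) (sum-zero (⊗-zeroʳ ∘ c ∘ fs)) ⟩
  c fz ⊕ 𝟎                             ≡⟨ ⊕-identityʳ (c fz) ⟩
  c fz                                 ∎
  where open ≡-Reasoning
sum-unitv↑ˡ {suc k} r c (fs q) =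
  trans (cong (_⊕ sum (λ j → c (fs j) ⊗ unitv (j ↑ˡ r) 𝟏 q)) (⊗-zeroʳ (c fz))) (sum-unitv↑ˡ r (tail4 c) q)

-- Generator matrix [1 1 | I_k | 0]: the codeword with message c is (Σ c, Σ c, c, 0).
parityBasis : ∀ {k} r → Fin k → Vec4 (2 + (k + r))
parityBasis r j fz = 𝟏
parityBasis r j (fs fz) = 𝟏
parityBasis r j (fs (fs q)) = unitv (j ↑ˡ r) 𝟏 q

parityCode : ∀ k r → Code (2 + (k + r)) k
parityCode k r = record { basis = parityBasis r ; indep = indep-parityBasis }
  where
  indep-parityBasis : ∀ c → IsZero (lincomb c (parityBasis r)) → IsZero c
  indep-parityBasis c lc≡𝟎 j = begin
    c j                                         ≡⟨ pad-↑ˡ r c j ⟨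
    pad r c (j ↑ˡ r)                            ≡⟨ sum-unitv↑ˡ r c (j ↑ˡ r) ⟨
    sum (λ l → c l ⊗ unitv (l ↑ˡ r) 𝟏 (j ↑ˡ r)) ≡⟨ lincomb-sum c (parityBasis r) (fs (fs (j ↑ˡ r))) ⟨
    lincomb c (parityBasis r) (fs (fs (j ↑ˡ r))) ≡⟨ lc≡𝟎 (fs (fs (j ↑ˡ r))) ⟩
    𝟎                                           ∎
    where open ≡-Reasoning

module _ {k r} {x : Vec4 (2 + (k + r))} {c : Vec4 k} (x≗ : x ≗ lincomb c (parityBasis r)) where

  parity : ∀ {p} → (∀ j → parityBasis r j p ≡ 𝟏) → x p ≡ sum c
  parity {p} ones = begin
    x p                                   ≡⟨ x≗ p ⟩
    lincomb c (parityBasis r) p           ≡⟨ lincomb-sum c (parityBasis r) p ⟩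
    sum (λ j → c j ⊗ parityBasis r j p)   ≡⟨ sum-cong (λ j → trans (cong (c j ⊗_) (ones j)) (⊗-identityʳ (c j))) ⟩
    sum c                                 ∎
    where open ≡-Reasoning

  message : ∀ q → x (fs (fs q)) ≡ pad r c q
  message q = trans (x≗ (fs (fs q))) (trans (lincomb-sum c (parityBasis r) (fs (fs q))) (sum-unitv↑ˡ r c q))

  weight-parityCodeword : weight x ≡ nz (sum c) + (nz (sum c) + weight c)
  weight-parityCodeword =
    cong₂ _+_ (cong nz (parity λ _ → refl))
      (cong₂ _+_ (cong nz (parity λ _ → refl)) (trans (weight-cong message) (weight-pad r c)))

  herm-parityBasis : ∀ l → herm x (parityBasis r l) ≡ c l
  herm-parityBasis l = begin
    herm x (parityBasis r l)                              ≡⟨ cong₂ _⊕_ (⊗-identityʳ (x fz))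
                                                             (cong₂ _⊕_ (⊗-identityʳ (x (fs fz))) (herm-unitvʳ _ (l ↑ˡ r))) ⟩
    x fz ⊕ (x (fs fz) ⊕ x (fs (fs (l ↑ˡ r))))            ≡⟨ cong₂ _⊕_ (parity λ _ → refl)
                                                             (cong₂ _⊕_ (parity λ _ → refl) (message (l ↑ˡ r))) ⟩
    sum c ⊕ (sum c ⊕ pad r c (l ↑ˡ r))                    ≡⟨ ⊕-cancelˡ (sum c) _ ⟩
    pad r c (l ↑ˡ r)                                      ≡⟨ pad-↑ˡ r c l ⟩
    c l                                                   ∎
    where open ≡-Reasoning

parityCode-hermLCD : ∀ k r → HermLCD (parityCode k r)
parityCode-hermLCD k r x (c , x≗) x⊥C p =
  trans (x≗ p) (lincomb-zeroˡ (parityBasis r) c≡𝟎 p)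
  where
  c≡𝟎 : IsZero c
  c≡𝟎 l = trans (sym (herm-parityBasis {k} {r} x≗ l)) (x⊥C _ (basis-∈C (parityCode k r) l))

2≤2nz[sum]+weight : ∀ {k} (c : Vec4 k) → ¬ IsZero c → 2 ≤ nz (sum c) + (nz (sum c) + weight c)
2≤2nz[sum]+weight c c≢𝟎 with weight c in w≡
... | 0 = ⊥-elim (c≢𝟎 (weight≡0⇒IsZero c w≡))
... | 1 rewrite ≢𝟎⇒nz≡1 (weight≡1⇒sum≢𝟎 c w≡) = s≤s (s≤s z≤n)
... | suc (suc w) = ≤-trans (s≤s (s≤s z≤n)) (≤-trans (m≤n+m _ (nz (sum c))) (m≤n+m _ (nz (sum c))))

parityCode-minWeight : ∀ k r → MinWeight (parityCode (2 + k) r) 2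
parityCode-minWeight k r = (x , (twoOnes , λ _ → refl) , x≢𝟎 , weight-x) , minimal
  where
  twoOnes : Vec4 (2 + k)
  twoOnes fz = 𝟏
  twoOnes (fs fz) = 𝟏
  twoOnes (fs (fs _)) = 𝟎
  x = lincomb twoOnes (parityBasis r)
  x≢𝟎 : ¬ IsZero x
  x≢𝟎 x≡𝟎 with () ← trans (sym (message {2 + k} {r} {x} {twoOnes} (λ _ → refl) fz)) (x≡𝟎 (fs (fs fz)))
  weight-x : weight x ≡ 2
  weight-x = begin
    weight x                                               ≡⟨ weight-parityCodeword {2 + k} {r} {x} {twoOnes} (λ _ → refl) ⟩
    nz (sum twoOnes) + (nz (sum twoOnes) + weight twoOnes) ≡⟨ cong₂ (λ s w → nz s + (nz s + w))
                                                                (cong (λ s → 𝟏 ⊕ (𝟏 ⊕ s)) (sum-𝟎ᵥ k))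
                                                                (cong (λ w → 2 + w) (weight-𝟎ᵥ k)) ⟩
    2                                                      ∎
    where open ≡-Reasoning
  minimal : ∀ y → y ∈C parityCode (2 + k) r → ¬ IsZero y → 2 ≤ weight y
  minimal y (c , y≗) y≢𝟎 = subst (2 ≤_) (sym (weight-parityCodeword {2 + k} {r} {y} {c} y≗))
    (2≤2nz[sum]+weight c λ c≡𝟎 → y≢𝟎 λ p → trans (y≗ p) (lincomb-zeroˡ (parityBasis r) c≡𝟎 p))

hermLCD-minWeight2-exists : ∀ {n k} → 2 ≤ k → 2 + k ≤ n → Σ (Code n k) λ C → HermLCD C × MinWeight C 2
hermLCD-minWeight2-exists {k = suc (suc k)} (s≤s (s≤s z≤n)) 2+k≤n with r , refl ← m≤n⇒∃[o]m+o≡n 2+k≤n =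
  parityCode (2 + k) r , parityCode-hermLCD (2 + k) r , parityCode-minWeight k r

3[1+i]<4^i : ∀ {i} → 2 ≤ i → 3 * suc i < 4 ^ i
3[1+i]<4^i {suc zero} (s≤s ())
3[1+i]<4^i {2} _ = s≤s (m≤m+n 9 6)
3[1+i]<4^i {suc (suc (suc j))} _ = begin-strict
  3 * (4 + j)                   ≡⟨ *-suc 3 (3 + j) ⟩
  3 + 3 * (3 + j)               <⟨ +-monoʳ-< 3 (3[1+i]<4^i {suc (suc j)} (s≤s (s≤s z≤n))) ⟩
  3 + 4 ^ (2 + j)               ≤⟨ +-monoˡ-≤ (4 ^ (2 + j)) (*-monoʳ-≤ 3 (m^n>0 4 (2 + j))) ⟩
  3 * 4 ^ (2 + j) + 4 ^ (2 + j) ≡⟨ +-comm (3 * 4 ^ (2 + j)) (4 ^ (2 + j)) ⟩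
  4 * 4 ^ (2 + j)               ∎
  where open ≤-Reasoning

2+i≤n : ∀ {i n} → 2 ≤ i → 4 ^ i ≤ 3 * n → 2 + i ≤ n
2+i≤n {i} {n} 2≤i 4^i≤3n = ≮⇒≥ λ n<2+i → <-irrefl refl (begin-strict
  3 * n     ≤⟨ *-monoʳ-≤ 3 (s≤s⁻¹ n<2+i) ⟩
  3 * suc i <⟨ 3[1+i]<4^i 2≤i ⟩
  4 ^ i     ≤⟨ 4^i≤3n ⟩
  3 * n     ∎)
  where open ≤-Reasoning

4^n<[1+3n]4^[n∸i] : ∀ {i n} → i ≤ n → 4 ^ i ≤ 3 * n → 4 ^ n < suc (3 * n) * 4 ^ (n ∸ i)
4^n<[1+3n]4^[n∸i] {i} {n} i≤n 4^i≤3n = begin-strict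
  4 ^ n                     ≡⟨ cong (4 ^_) (m+[n∸m]≡n i≤n) ⟨
  4 ^ (i + (n ∸ i))         ≡⟨ ^-distribˡ-+-* 4 i (n ∸ i) ⟩
  4 ^ i * 4 ^ (n ∸ i)       <⟨ *-monoˡ-< (4 ^ (n ∸ i)) {{m^n≢0 4 (n ∸ i)}} (s≤s 4^i≤3n) ⟩
  suc (3 * n) * 4 ^ (n ∸ i) ∎
  where open ≤-Reasoning

lemma3p2 : ∀ (n i : ℕ) → 2 ≤ i → i < n → (4 ^ i) ∸ 1 < 3 * n → IsD4 n (n ∸ i) 2
lemma3p2 n i 2≤i i<n 4^i∸1<3n =
  hermLCD-minWeight2-exists 2≤n∸i 2+[n∸i]≤n ,
  λ C _ _ → minWeight≤2 C (4^n<[1+3n]4^[n∸i] (<⇒≤ i<n) 4^i≤3n)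
  where
  4^i≤3n : 4 ^ i ≤ 3 * n
  4^i≤3n = subst (_≤ 3 * n) (suc-pred (4 ^ i) {{m^n≢0 4 i}}) 4^i∸1<3n
  2≤n∸i : 2 ≤ n ∸ i
  2≤n∸i = subst (_≤ n ∸ i) (m+n∸n≡m 2 i) (∸-monoˡ-≤ i (2+i≤n 2≤i 4^i≤3n))
  2+[n∸i]≤n : 2 + (n ∸ i) ≤ n
  2+[n∸i]≤n = ≤-trans (+-monoˡ-≤ (n ∸ i) 2≤i) (≤-reflexive (m+[n∸m]≡n (<⇒≤ i<n)))
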